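{- For every prime $p$, \[ \sum_{k=0}^{2p-1} \binom{2k}{k} \equiv \begin{cases} 3 \pmod p, & \text{if } p\equiv 1 \pmod 3,\\ -3 \pmod p, & \text{if } p\equiv 2 \pmod 3. \end{cases} \] -}

module Defs where

open import Data.Nat using (ℕ; _*_)
open import Data.List using (upTo; map)
open import Data.Nat.ListAction using (sum)
open import Data.Nat.Combinatorics using (_C_)

centralBinomSum : ℕ → ℕ
centralBinomSum n = sum (map (λ k → (2 * k) C k) (upTo n))

-- With p = 2n + 1, the central binomial coefficients a k = C(2k, k) satisfy
-- (k + 1) a (k + 1) = 2(2k + 1) a k.  Modulo p the sequence C(n, k) (-4)^k obeys the same
-- recurrence, because -4(n - k) and 2(2k + 1) differ by 2p; cancelling k + 1 < p gives
-- a k ≡ C(n, k) (-4)^k for k < p, so the first p terms sum to (1 - 4)^n = (-3)^n.  The same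
-- argument shows a (p + j) ≡ 2 a j, so the full sum up to 2p is 3 (-3)^n.  Finally (-3)^n is
-- the Legendre symbol of -3: in the Eisenstein integers, 1 + 2ω = ω + (1 + ω) squares to -3,
-- so by the Frobenius congruence (-3)^n (1 + 2ω) = (1 + 2ω)^p ≡ ω^p + (1 + ω)^p, and ω and
-- 1 + ω are sixth roots of unity, whence the right-hand side only depends on p mod 6.
module Submission where

open import Data.Nat using (ℕ)
open import Data.Integer using (ℤ)
open import Data.Nat.Primality using (Prime)
open import Algebra.Bundles using (Monoid; CommutativeSemiring)

module BinomialCoefficients where

  open import Data.Nat
  open import Data.Nat.Properties
  open import Data.Nat.Combinatorics using (_C_; nC1≡n; nCk≡nC[n∸k]; nCk+nC[k+1]≡[n+1]C[k+1])
  open import Data.Nat.Divisibility using (_∣_; divides; ∣⇒≤)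
  open import Data.Nat.Primality using (euclidsLemma)
  open import Data.Nat.Tactic.RingSolver using (solve-∀)
  open import Data.Bool using (true; false; T)
  open import Data.Unit using (tt)
  open import Data.Sum using (inj₁; inj₂)
  open import Relation.Nullary using (contradiction)
  open import Relation.Binary.PropositionalEquality

  [n+1]C[k+1]*[k+1]≡[n+1]*nCk : ∀ n k → (suc n C suc k) * suc k ≡ suc n * (n C k)
  [n+1]C[k+1]*[k+1]≡[n+1]*nCk zero    zero    = refl
  [n+1]C[k+1]*[k+1]≡[n+1]*nCk zero    (suc k) = refl
  [n+1]C[k+1]*[k+1]≡[n+1]*nCk (suc n) zero    = begin
    (suc (suc n) C 1) * 1 ≡⟨ *-identityʳ _ ⟩
    suc (suc n) C 1       ≡⟨ nC1≡n (suc (suc n)) ⟩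
    suc (suc n)           ≡⟨ *-identityʳ _ ⟨
    suc (suc n) * 1       ∎
    where open ≡-Reasoning
  [n+1]C[k+1]*[k+1]≡[n+1]*nCk (suc n) (suc k) = begin
    (suc m C suc (suc k)) * suc (suc k)
      ≡⟨ cong (_* suc (suc k)) (nCk+nC[k+1]≡[n+1]C[k+1] m (suc k)) ⟨
    (m C suc k + m C suc (suc k)) * suc (suc k)
      ≡⟨ split (m C suc k) (m C suc (suc k)) k ⟩
    m C suc k + (m C suc k) * suc k + (m C suc (suc k)) * suc (suc k)
      ≡⟨ cong₂ (λ u v → m C suc k + u + v)
               ([n+1]C[k+1]*[k+1]≡[n+1]*nCk n k) ([n+1]C[k+1]*[k+1]≡[n+1]*nCk n (suc k)) ⟩
    m C suc k + m * (n C k) + m * (n C suc k)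
      ≡⟨ merge (m C suc k) m (n C k) (n C suc k) ⟩
    m C suc k + m * (n C k + n C suc k)
      ≡⟨ cong (λ c → m C suc k + m * c) (nCk+nC[k+1]≡[n+1]C[k+1] n k) ⟩
    suc m * (m C suc k)
      ∎
    where
    open ≡-Reasoning
    m : ℕ
    m = suc n
    split : ∀ a b k → (a + b) * suc (suc k) ≡ a + a * suc k + b * suc (suc k)
    split = solve-∀
    merge : ∀ a m c d → a + m * c + m * d ≡ a + m * (c + d)
    merge = solve-∀

  [k+1]*[2k+2]C[k+1]≡2[2k+1]*[2k]Ck : ∀ k → suc k * ((2 * suc k) C suc k) ≡ 2 * suc (2 * k) * ((2 * k) C k)
  [k+1]*[2k+2]C[k+1]≡2[2k+1]*[2k]Ck k = begin
    suc k * ((2 * suc k) C suc k)       ≡⟨ *-comm (suc k) _ ⟩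
    ((2 * suc k) C suc k) * suc k       ≡⟨ cong (λ m → (m C suc k) * suc k) (2[k+1]≡2+2k k) ⟩
    (suc (suc m) C suc k) * suc k       ≡⟨ [n+1]C[k+1]*[k+1]≡[n+1]*nCk (suc m) k ⟩
    suc (suc m) * (suc m C k)           ≡⟨ cong (suc (suc m) *_) (nCk≡nC[n∸k] k≤2k+1) ⟩
    suc (suc m) * (suc m C (suc m ∸ k)) ≡⟨ cong (λ j → suc (suc m) * (suc m C j)) ([2k+1]∸k≡k+1 k) ⟩
    suc (suc m) * (suc m C suc k)       ≡⟨ regroup (suc m C suc k) k ⟩
    2 * ((suc m C suc k) * suc k)       ≡⟨ cong (2 *_) ([n+1]C[k+1]*[k+1]≡[n+1]*nCk m k) ⟩
    2 * (suc m * (m C k))               ≡⟨ *-assoc 2 (suc m) (m C k) ⟨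
    2 * suc m * (m C k)                 ∎
    where
    open ≡-Reasoning
    m : ℕ
    m = 2 * k
    k≤2k+1 : k ≤ suc m
    k≤2k+1 = ≤-trans (m≤m+n k (k + 0)) (n≤1+n m)
    2[k+1]≡2+2k : ∀ k → 2 * suc k ≡ suc (suc (2 * k))
    2[k+1]≡2+2k = solve-∀
    2k+1≡k+[k+1] : ∀ k → suc (2 * k) ≡ k + suc k
    2k+1≡k+[k+1] = solve-∀
    [2k+1]∸k≡k+1 : ∀ k → suc (2 * k) ∸ k ≡ suc k
    [2k+1]∸k≡k+1 k = trans (cong (_∸ k) (2k+1≡k+[k+1] k)) (m+n∸m≡n k (suc k))
    regroup : ∀ x k → suc (suc (2 * k)) * x ≡ 2 * (x * suc k)
    regroup = solve-∀

  4[k+1]nC[k+1]+2[2k+1]nCk≡2[2n+1]nCk : ∀ n k →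
    4 * (suc k * (n C suc k)) + 2 * suc (2 * k) * (n C k) ≡ 2 * suc (2 * n) * (n C k)
  4[k+1]nC[k+1]+2[2k+1]nCk≡2[2n+1]nCk n k = +-cancelʳ-≡ _ _ _ (begin
    4 * (suc k * c₁) + 2 * suc (2 * k) * c₀ + 2 * c₀ ≡⟨ regroup k c₀ c₁ ⟩
    4 * ((c₀ + c₁) * suc k)                          ≡⟨ cong (4 *_) pascal-absorption ⟩
    4 * (suc n * c₀)                                 ≡⟨ expand n c₀ ⟩
    2 * suc (2 * n) * c₀ + 2 * c₀                    ∎)
    where
    open ≡-Reasoning
    c₀ c₁ : ℕ
    c₀ = n C k
    c₁ = n C suc k
    pascal-absorption : (c₀ + c₁) * suc k ≡ suc n * c₀
    pascal-absorption = trans (cong (_* suc k) (nCk+nC[k+1]≡[n+1]C[k+1] n k)) ([n+1]C[k+1]*[k+1]≡[n+1]*nCk n k)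
    regroup : ∀ k c₀ c₁ → 4 * (suc k * c₁) + 2 * suc (2 * k) * c₀ + 2 * c₀ ≡ 4 * ((c₀ + c₁) * suc k)
    regroup = solve-∀
    expand : ∀ n c₀ → 4 * (suc n * c₀) ≡ 2 * suc (2 * n) * c₀ + 2 * c₀
    expand = solve-∀

  n<k⇒nCk≡0 : ∀ {n k} → n < k → n C k ≡ 0
  n<k⇒nCk≡0 {n} {k} n<k with k ≤ᵇ n in k≤ᵇn
  ... | false = refl
  ... | true  = contradiction (≤ᵇ⇒≤ k n (subst T (sym k≤ᵇn) tt)) (<⇒≱ n<k)

  prime∣pCk : ∀ {p k} → Prime p → 0 < k → k < p → p ∣ p C k
  prime∣pCk {suc m} {suc j} p-prime _ j<m with euclidsLemma (suc m C suc j) (suc j) p-prime p∣pCk*k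
    where
    p∣pCk*k : suc m ∣ (suc m C suc j) * suc j
    p∣pCk*k = divides (m C j) (trans ([n+1]C[k+1]*[k+1]≡[n+1]*nCk m j) (*-comm (suc m) (m C j)))
  ... | inj₁ p∣pCk = p∣pCk
  ... | inj₂ p∣k   = contradiction (∣⇒≤ p∣k) (<⇒≱ j<m)

open BinomialCoefficients

module CommutativeSemiringFacts {c ℓ} (R : CommutativeSemiring c ℓ) where

  open import Data.Nat as ℕ using (zero; suc; z≤n; s≤s; _∸_; _%_; _/_; NonZero)
  import Data.Nat.Properties as ℕ
  open import Data.Nat.Combinatorics using (_C_; nCn≡1)
  open import Data.Nat.Divisibility using (_∣_; divides)
  open import Data.Nat.DivMod using (m≡m%n+[m/n]*n)
  open import Data.Nat.Primality using (¬prime[0]; ¬prime[1])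
  open import Data.Fin as Fin using (Fin; toℕ; inject₁; fromℕ)
  open import Data.Fin.Properties using (toℕ-inject₁; toℕ-fromℕ; toℕ<n)
  open import Data.Vec.Functional using (init)
  open import Function using (_∘_)
  open import Relation.Nullary using (contradiction)
  open import Relation.Binary.PropositionalEquality as ≡ using (_≡_)

  open CommutativeSemiring R hiding (zero)
  open import Algebra.Properties.Semiring.Mult semiring using (_×_; ×-congˡ; ×-congʳ; ×-assocˡ; ×-assoc-*; ×-homo-1)
  open import Algebra.Properties.Semiring.Exp semiring using (_^_; ^-homo-*; ^-assocʳ; ^-congˡ)
  open import Algebra.Properties.Semiring.Sum semiring using (sum; sum-cong-≋; sum-replicate-zero; sum-init-last)
  open import Algebra.Properties.CommutativeSemiring.Binomial R using (theorem; binomialTerm)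
  open import Relation.Binary.Reasoning.Setoid setoid

  1#^n≈1# : ∀ n → 1# ^ n ≈ 1#
  1#^n≈1# zero    = refl
  1#^n≈1# (suc n) = trans (*-identityˡ _) (1#^n≈1# n)

  ^-periodic : ∀ {x} d .{{_ : NonZero d}} → x ^ d ≈ 1# → ∀ e → x ^ e ≈ x ^ (e % d)
  ^-periodic {x} d x^d≈1 e = begin
    x ^ e                             ≡⟨ ≡.cong (x ^_) (m≡m%n+[m/n]*n e d) ⟩
    x ^ (e % d ℕ.+ e / d ℕ.* d)       ≈⟨ ^-homo-* x (e % d) (e / d ℕ.* d) ⟩
    x ^ (e % d) * x ^ (e / d ℕ.* d)   ≡⟨ ≡.cong (λ k → x ^ (e % d) * x ^ k) (ℕ.*-comm (e / d) d) ⟩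
    x ^ (e % d) * x ^ (d ℕ.* (e / d)) ≈⟨ *-congˡ (^-assocʳ x d (e / d)) ⟨
    x ^ (e % d) * (x ^ d) ^ (e / d)   ≈⟨ *-congˡ (trans (^-congˡ (e / d) x^d≈1) (1#^n≈1# (e / d))) ⟩
    x ^ (e % d) * 1#                  ≈⟨ *-identityʳ _ ⟩
    x ^ (e % d)                       ∎

  module _ {p : ℕ} (p×1≈0 : p × 1# ≈ 0#) where

    p×x≈0 : ∀ x → p × x ≈ 0#
    p×x≈0 x = begin
      p × x          ≈⟨ ×-congʳ p (*-identityˡ x) ⟨
      p × (1# * x)   ≈⟨ ×-assoc-* p 1# x ⟨
      (p × 1#) * x   ≈⟨ *-congʳ p×1≈0 ⟩
      0# * x         ≈⟨ zeroˡ x ⟩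
      0#             ∎

    ∣⇒×≈0 : ∀ {k} → p ∣ k → ∀ x → k × x ≈ 0#
    ∣⇒×≈0 (divides q ≡.refl) x = begin
      (q ℕ.* p) × x  ≈⟨ ×-congˡ (ℕ.*-comm q p) ⟩
      (p ℕ.* q) × x  ≈⟨ ×-assocˡ x p q ⟨
      p × (q × x)    ≈⟨ p×x≈0 (q × x) ⟩
      0#             ∎

  frobenius : ∀ {p} → Prime p → p × 1# ≈ 0# → ∀ x y → (x + y) ^ p ≈ x ^ p + y ^ p
  frobenius {0} p-prime = contradiction p-prime ¬prime[0]
  frobenius {1} p-prime = contradiction p-prime ¬prime[1]
  frobenius {p@(suc (suc m))} p-prime p×1≈0 x y = begin
    (x + y) ^ p                                       ≈⟨ theorem p x y ⟩
    T Fin.zero + sum (T ∘ Fin.suc)                    ≈⟨ +-congˡ (sum-init-last (T ∘ Fin.suc)) ⟩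
    T Fin.zero + (sum (init (T ∘ Fin.suc)) + T (fromℕ p)) ≈⟨ +-cong first (+-cong middle final) ⟩
    y ^ p + (0# + x ^ p)                              ≈⟨ +-congˡ (+-identityˡ (x ^ p)) ⟩
    y ^ p + x ^ p                                     ≈⟨ +-comm (y ^ p) (x ^ p) ⟩
    x ^ p + y ^ p                                     ∎
    where
    T : Fin (suc p) → Carrier
    T = binomialTerm x y p
    first : T Fin.zero ≈ y ^ p
    first = trans (×-homo-1 _) (*-identityˡ _)
    middle : sum (init (T ∘ Fin.suc)) ≈ 0#
    middle = trans (sum-cong-≋ vanish) (sum-replicate-zero (suc m))
      where
      vanish : ∀ i → T (Fin.suc (inject₁ i)) ≈ 0#
      vanish i = ∣⇒×≈0 p×1≈0 (prime∣pCk p-prime (s≤s z≤n) k<p) _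
        where k<p : suc (toℕ (inject₁ i)) ℕ.< p
              k<p = s≤s (ℕ.≤-trans (ℕ.≤-reflexive (≡.cong suc (toℕ-inject₁ i))) (toℕ<n i))
    final : T (fromℕ p) ≈ x ^ p
    final = begin
      T (fromℕ p)                      ≈⟨ reflexive (≡.cong (λ k → (p C k) × (x ^ k * y ^ (p ∸ k))) (toℕ-fromℕ p)) ⟩
      (p C p) × (x ^ p * y ^ (p ∸ p))  ≈⟨ reflexive (≡.cong₂ (λ c k → c × (x ^ p * y ^ k)) (nCn≡1 p) (ℕ.n∸n≡0 p)) ⟩
      1 × (x ^ p * 1#)                 ≈⟨ ×-homo-1 _ ⟩
      x ^ p * 1#                       ≈⟨ *-identityʳ _ ⟩
      x ^ p                            ∎

module IndexedSum {c ℓ} (M : Monoid c ℓ) where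

  open import Data.Nat using (zero; suc; _+_)
  open import Data.Fin using (toℕ)
  open import Function using (_∘_)
  open Monoid M
  open import Algebra.Properties.Monoid.Sum M using (sum-syntax)

  ∑-split : ∀ m n (f : ℕ → Carrier) →
            ∑[ k < m + n ] f (toℕ k) ≈ ∑[ k < m ] f (toℕ k) ∙ ∑[ k < n ] f (m + toℕ k)
  ∑-split zero    n f = sym (identityˡ _)
  ∑-split (suc m) n f = trans (∙-congˡ (∑-split m n (f ∘ suc))) (sym (assoc _ _ _))

module Modulo (m : ℤ) where

  open import Data.Nat as ℕ using (zero; suc; _<_)
  open import Data.Nat.ListAction using (sum)
  open import Data.Integer using (+_; -_; _+_; _*_; _-_; 0ℤ; 1ℤ)
  import Data.Integer.Properties as ℤ
  open import Data.Integer.Divisibility.Signed using (_∣_; divides; ∣m∣n⇒∣m+n; ∣m⇒∣-m; ∣n⇒∣m*n; ∣m⇒∣m*n)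
  open import Data.Integer.Tactic.RingSolver using (solve-∀)
  open import Data.Fin using (toℕ)
  open import Data.Fin.Properties using (toℕ<n)
  open import Data.List using (map; applyUpTo)
  open import Data.Product using (_×_; _,_)
  open import Data.Product.Relation.Binary.Pointwise.NonDependent using (Pointwise; ×-isEquivalence)
  open import Function using (_∘_)
  open import Algebra.Structures using (IsCommutativeSemiring)
  open import Relation.Binary.Structures using (IsEquivalence)
  open import Relation.Binary.PropositionalEquality as ≡ using (_≡_)
  import Relation.Binary.Reasoning.Setoid

  infix 4 _≈_
  record _≈_ (x y : ℤ) : Set where
    constructor mod
    field ∣-difference : m ∣ x - y

  ∣⇒≈ : ∀ {a x y} → a ≡ x - y → m ∣ a → x ≈ y
  ∣⇒≈ a≡x-y m∣a = mod (≡.subst (m ∣_) a≡x-y m∣a)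

  ≈-reflexive : ∀ {x y} → x ≡ y → x ≈ y
  ≈-reflexive {x} ≡.refl = mod (divides 0ℤ (≡.trans (ℤ.+-inverseʳ x) (≡.sym (ℤ.*-zeroˡ m))))

  ≈-refl : ∀ {x} → x ≈ x
  ≈-refl = ≈-reflexive ≡.refl

  ≈-sym : ∀ {x y} → x ≈ y → y ≈ x
  ≈-sym {x} {y} (mod x≈y) = ∣⇒≈ (swap x y) (∣m⇒∣-m x≈y)
    where swap : ∀ x y → - (x - y) ≡ y - x
          swap = solve-∀

  ≈-trans : ∀ {x y z} → x ≈ y → y ≈ z → x ≈ z
  ≈-trans {x} {y} {z} (mod x≈y) (mod y≈z) = ∣⇒≈ (telescope x y z) (∣m∣n⇒∣m+n x≈y y≈z)
    where telescope : ∀ x y z → (x - y) + (y - z) ≡ x - z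
          telescope = solve-∀

  x+q*m≈x : ∀ x q → x + q * m ≈ x
  x+q*m≈x x q = ∣⇒≈ (cancel x q m) (divides q ≡.refl)
    where cancel : ∀ x q m → q * m ≡ x + q * m - x
          cancel = solve-∀

  m≈0 : m ≈ 0ℤ
  m≈0 = ≈-trans (≈-reflexive (m≡0+1*m m)) (x+q*m≈x 0ℤ 1ℤ)
    where m≡0+1*m : ∀ m → m ≡ 0ℤ + 1ℤ * m
          m≡0+1*m = solve-∀

  ≈-isEquivalence : IsEquivalence _≈_
  ≈-isEquivalence = record { refl = ≈-refl ; sym = ≈-sym ; trans = ≈-trans }

  +-cong : ∀ {x y u v} → x ≈ y → u ≈ v → x + u ≈ y + v
  +-cong {x} {y} {u} {v} (mod x≈y) (mod u≈v) = ∣⇒≈ (regroup x y u v) (∣m∣n⇒∣m+n x≈y u≈v)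
    where regroup : ∀ x y u v → (x - y) + (u - v) ≡ (x + u) - (y + v)
          regroup = solve-∀

  +-congˡ : ∀ z {x y} → x ≈ y → z + x ≈ z + y
  +-congˡ z = +-cong (≈-refl {z})

  *-cong : ∀ {x y u v} → x ≈ y → u ≈ v → x * u ≈ y * v
  *-cong {x} {y} {u} {v} (mod x≈y) (mod u≈v) =
    ∣⇒≈ (regroup x y u v) (∣m∣n⇒∣m+n (∣m⇒∣m*n u x≈y) (∣n⇒∣m*n y u≈v))
    where regroup : ∀ x y u v → (x - y) * u + y * (u - v) ≡ x * u - y * v
          regroup = solve-∀

  *-congˡ : ∀ z {x y} → x ≈ y → z * x ≈ z * y
  *-congˡ z = *-cong (≈-refl {z})

  *-congʳ : ∀ z {x y} → x ≈ y → x * z ≈ y * z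
  *-congʳ z x≈y = *-cong x≈y (≈-refl {z})

  -‿cong : ∀ {x y} → x ≈ y → - x ≈ - y
  -‿cong {x} {y} (mod x≈y) = ∣⇒≈ (regroup x y) (∣m⇒∣-m x≈y)
    where regroup : ∀ x y → - (x - y) ≡ - x - - y
          regroup = solve-∀

  minus-cong : ∀ {x y u v} → x ≈ y → u ≈ v → x - u ≈ y - v
  minus-cong x≈y u≈v = +-cong x≈y (-‿cong u≈v)

  ℤ/m-isCommutativeSemiring : IsCommutativeSemiring _≈_ _+_ _*_ 0ℤ 1ℤ
  ℤ/m-isCommutativeSemiring = isCommutativeSemiringˡ record
    { +-isCommutativeMonoid = isCommutativeMonoidˡ record
      { isSemigroup = record
        { isMagma = record { isEquivalence = ≈-isEquivalence ; ∙-cong = +-cong }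
        ; assoc = λ x y z → ≈-reflexive (ℤ.+-assoc x y z) }
      ; identityˡ = λ x → ≈-reflexive (ℤ.+-identityˡ x)
      ; comm = λ x y → ≈-reflexive (ℤ.+-comm x y) }
    ; *-isCommutativeMonoid = isCommutativeMonoidˡ record
      { isSemigroup = record
        { isMagma = record { isEquivalence = ≈-isEquivalence ; ∙-cong = *-cong }
        ; assoc = λ x y z → ≈-reflexive (ℤ.*-assoc x y z) }
      ; identityˡ = λ x → ≈-reflexive (ℤ.*-identityˡ x)
      ; comm = λ x y → ≈-reflexive (ℤ.*-comm x y) }
    ; distribʳ = λ x y z → ≈-reflexive (ℤ.*-distribʳ-+ x y z)
    ; zeroˡ = λ x → ≈-reflexive (ℤ.*-zeroˡ x)
    }
    where open import Algebra.Structures.Biased _≈_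

  ℤ/m : CommutativeSemiring _ _
  ℤ/m = record { isCommutativeSemiring = ℤ/m-isCommutativeSemiring }

  module ≈-Reasoning = Relation.Binary.Reasoning.Setoid (CommutativeSemiring.setoid ℤ/m)

  ℤ[ω] : Set
  ℤ[ω] = ℤ × ℤ

  infix 4 _≋_
  _≋_ : ℤ[ω] → ℤ[ω] → Set
  _≋_ = Pointwise _≈_ _≈_

  infixl 6 _⊕_
  infixl 7 _⊗_
  -- (a + bω)(c + dω) reduced with ω² = -1 - ω.
  _⊕_ _⊗_ : ℤ[ω] → ℤ[ω] → ℤ[ω]
  (a , b) ⊕ (c , d) = a + c , b + d
  (a , b) ⊗ (c , d) = a * c - b * d , a * d + b * c - b * d

  ≡⇒≋ : ∀ {a b c d} → a ≡ c → b ≡ d → (a , b) ≋ (c , d)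
  ≡⇒≋ a≡c b≡d = ≈-reflexive a≡c , ≈-reflexive b≡d

  ℤ[ω]/m-isCommutativeSemiring : IsCommutativeSemiring _≋_ _⊕_ _⊗_ (0ℤ , 0ℤ) (1ℤ , 0ℤ)
  ℤ[ω]/m-isCommutativeSemiring = isCommutativeSemiringˡ record
    { +-isCommutativeMonoid = isCommutativeMonoidˡ record
      { isSemigroup = record
        { isMagma = record
          { isEquivalence = ×-isEquivalence ≈-isEquivalence ≈-isEquivalence
          ; ∙-cong = λ (a , b) (c , d) → +-cong a c , +-cong b d }
        ; assoc = λ (a , b) (c , d) (e , f) → ≡⇒≋ (ℤ.+-assoc a c e) (ℤ.+-assoc b d f) }
      ; identityˡ = λ (a , b) → ≡⇒≋ (ℤ.+-identityˡ a) (ℤ.+-identityˡ b)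
      ; comm = λ (a , b) (c , d) → ≡⇒≋ (ℤ.+-comm a c) (ℤ.+-comm b d) }
    ; *-isCommutativeMonoid = isCommutativeMonoidˡ record
      { isSemigroup = record
        { isMagma = record
          { isEquivalence = ×-isEquivalence ≈-isEquivalence ≈-isEquivalence
          ; ∙-cong = λ (a , b) (c , d) →
              minus-cong (*-cong a c) (*-cong b d) , minus-cong (+-cong (*-cong a d) (*-cong b c)) (*-cong b d) }
        ; assoc = λ (a , b) (c , d) (e , f) → ≡⇒≋ (*-assoc₁ a b c d e f) (*-assoc₂ a b c d e f) }
      ; identityˡ = λ (a , b) → ≡⇒≋ (*-identityˡ₁ a b) (*-identityˡ₂ a b)
      ; comm = λ (a , b) (c , d) → ≡⇒≋ (*-comm₁ a b c d) (*-comm₂ a b c d) }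
    ; distribʳ = λ (a , b) (c , d) (e , f) → ≡⇒≋ (distribʳ₁ a b c d e f) (distribʳ₂ a b c d e f)
    ; zeroˡ = λ (a , b) → ≡⇒≋ (zeroˡ₁ a b) (zeroˡ₂ a b)
    }
    where
    open import Algebra.Structures.Biased _≋_
    *-assoc₁ : ∀ a b c d e f → (a * c - b * d) * e - (a * d + b * c - b * d) * f
                             ≡ a * (c * e - d * f) - b * (c * f + d * e - d * f)
    *-assoc₁ = solve-∀
    *-assoc₂ : ∀ a b c d e f → (a * c - b * d) * f + (a * d + b * c - b * d) * e - (a * d + b * c - b * d) * f
                             ≡ a * (c * f + d * e - d * f) + b * (c * e - d * f) - b * (c * f + d * e - d * f)
    *-assoc₂ = solve-∀
    *-identityˡ₁ : ∀ a b → 1ℤ * a - 0ℤ * b ≡ a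
    *-identityˡ₁ = solve-∀
    *-identityˡ₂ : ∀ a b → 1ℤ * b + 0ℤ * a - 0ℤ * b ≡ b
    *-identityˡ₂ = solve-∀
    *-comm₁ : ∀ a b c d → a * c - b * d ≡ c * a - d * b
    *-comm₁ = solve-∀
    *-comm₂ : ∀ a b c d → a * d + b * c - b * d ≡ c * b + d * a - d * b
    *-comm₂ = solve-∀
    distribʳ₁ : ∀ a b c d e f → (c + e) * a - (d + f) * b ≡ (c * a - d * b) + (e * a - f * b)
    distribʳ₁ = solve-∀
    distribʳ₂ : ∀ a b c d e f → (c + e) * b + (d + f) * a - (d + f) * b
                              ≡ (c * b + d * a - d * b) + (e * b + f * a - f * b)
    distribʳ₂ = solve-∀
    zeroˡ₁ : ∀ a b → 0ℤ * a - 0ℤ * b ≡ 0ℤ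
    zeroˡ₁ = solve-∀
    zeroˡ₂ : ∀ a b → 0ℤ * b + 0ℤ * a - 0ℤ * b ≡ 0ℤ
    zeroˡ₂ = solve-∀

  ℤ[ω]/m : CommutativeSemiring _ _
  ℤ[ω]/m = record { isCommutativeSemiring = ℤ[ω]/m-isCommutativeSemiring }

  open CommutativeSemiring ℤ/m using (semiring)
  open import Algebra.Properties.Semiring.Sum semiring using (sum-syntax; sum-cong-≋)
  open import Algebra.Properties.Semiring.Mult semiring using () renaming (_×_ to _×ₙ_)

  ∑-cong : ∀ {N} {f g : ℕ → ℤ} → (∀ {k} → k < N → f k ≈ g k) → ∑[ k < N ] f (toℕ k) ≈ ∑[ k < N ] g (toℕ k)
  ∑-cong f≈g = sum-cong-≋ (λ i → f≈g (toℕ<n i))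

  ×≡pos-* : ∀ k x → k ×ₙ x ≡ + k * x
  ×≡pos-* zero    x = ≡.sym (ℤ.*-zeroˡ x)
  ×≡pos-* (suc k) x = ≡.trans (≡.cong (_+_ x) (×≡pos-* k x)) (≡.sym (ℤ.suc-* (+ k) x))

  pos-sum-map-applyUpTo : ∀ (g f : ℕ → ℕ) N → + sum (map g (applyUpTo f N)) ≡ ∑[ k < N ] (+ g (f (toℕ k)))
  pos-sum-map-applyUpTo g f zero    = ≡.refl
  pos-sum-map-applyUpTo g f (suc N) =
    ≡.trans (ℤ.pos-+ (g (f 0)) _) (≡.cong (_+_ (+ g (f 0))) (pos-sum-map-applyUpTo g (f ∘ suc) N))

module ModuloPrime (p : ℕ) (p-prime : Prime p) where

  open import Data.Nat as ℕ using (zero; suc; _<_; _≤_; z≤n; s≤s; _%_)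
  import Data.Nat.Properties as ℕ
  import Data.Nat.Divisibility as ℕ
  open import Data.Nat.DivMod using (%-remove-+ʳ)
  open import Data.Nat.Primality using (euclidsLemma; prime⇒nonZero)
  open import Data.Integer using (+_; _+_; _*_; _-_; ∣_∣)
  import Data.Integer.Properties as ℤ
  open import Data.Integer.Divisibility.Signed using (_∣_; ∣⇒∣ᵤ; ∣ᵤ⇒∣)
  open import Data.Integer.Tactic.RingSolver using (solve-∀)
  open import Data.Sum using (inj₁; inj₂)
  open import Relation.Nullary using (contradiction)
  open import Relation.Binary.PropositionalEquality as ≡ using (_≡_)

  open Modulo (+ p) public

  private instance
    p≢0 : ℕ.NonZero p
    p≢0 = prime⇒nonZero p-prime

  *-cancelˡ-≈ : ∀ {k x y} → 0 < k → k < p → + k * x ≈ + k * y → x ≈ y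
  *-cancelˡ-≈ {k@(suc _)} {x} {y} _ k<p (mod p∣kx-ky)
    with euclidsLemma k ∣ x - y ∣ p-prime (≡.subst (p ℕ.∣_) (ℤ.abs-* (+ k) (x - y)) (∣⇒∣ᵤ p∣k[x-y]))
    where
    factor : ∀ k x y → k * x - k * y ≡ k * (x - y)
    factor = solve-∀
    p∣k[x-y] : + p ∣ + k * (x - y)
    p∣k[x-y] = ≡.subst (+ p ∣_) (factor (+ k) x y) p∣kx-ky
  ... | inj₁ p∣k   = contradiction (ℕ.∣⇒≤ p∣k) (ℕ.<⇒≱ k<p)
  ... | inj₂ p∣x-y = mod (∣ᵤ⇒∣ p∣x-y)

  ≡n+kp⇒+≈+n : ∀ n k {l} → l ≡ n ℕ.+ k ℕ.* p → + l ≈ + n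
  ≡n+kp⇒+≈+n n k ≡.refl = ≈-trans (≈-reflexive (≡.trans (ℤ.pos-+ n (k ℕ.* p)) (≡.cong (_+_ (+ n)) (ℤ.pos-* k p))))
                                  (x+q*m≈x (+ n) (+ k))

  ≤∧+≈+⇒%≡ : ∀ {x y} → y ≤ x → + x ≈ + y → x % p ≡ y % p
  ≤∧+≈+⇒%≡ {x} {y} y≤x (mod p∣x-y) = begin
    x % p                   ≡⟨ ≡.cong (_% p) (ℕ.m+[n∸m]≡n y≤x) ⟨
    (y ℕ.+ (x ℕ.∸ y)) % p   ≡⟨ %-remove-+ʳ y p∣x∸y ⟩
    y % p                   ∎
    where
    open ≡.≡-Reasoning
    ∣x-y∣≡x∸y : ∣ + x - + y ∣ ≡ x ℕ.∸ y
    ∣x-y∣≡x∸y =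
      ≡.trans (≡.cong ∣_∣ (ℤ.m-n≡m⊖n x y)) (≡.trans (ℤ.∣m⊖n∣≡∣n⊖m∣ x y) (ℤ.∣⊖∣-≤ y≤x))
    p∣x∸y : p ℕ.∣ x ℕ.∸ y
    p∣x∸y = ≡.subst (p ℕ.∣_) ∣x-y∣≡x∸y (∣⇒∣ᵤ p∣x-y)

  +≈+⇒%≡ : ∀ {x y} → + x ≈ + y → x % p ≡ y % p
  +≈+⇒%≡ {x} {y} x≈y with ℕ.≤-total y x
  ... | inj₁ y≤x = ≤∧+≈+⇒%≡ y≤x x≈y
  ... | inj₂ x≤y = ≡.sym (≤∧+≈+⇒%≡ x≤y (≈-sym x≈y))

  SolvesRecurrence : (ℕ → ℤ) → (ℕ → ℤ) → Set
  SolvesRecurrence c u = ∀ {k} → suc k < p → + suc k * u (suc k) ≈ c k * u k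

  recurrence-unique : ∀ {c u v} → SolvesRecurrence c u → SolvesRecurrence c v →
                      u 0 ≈ v 0 → ∀ {k} → k < p → u k ≈ v k
  recurrence-unique _ _ u₀≈v₀ {zero} _ = u₀≈v₀
  recurrence-unique {c} {u} {v} u-solves v-solves u₀≈v₀ {suc k} k+1<p = *-cancelˡ-≈ (s≤s z≤n) k+1<p (begin
    + suc k * u (suc k)   ≈⟨ u-solves k+1<p ⟩
    c k * u k             ≈⟨ *-congˡ (c k) uₖ≈vₖ ⟩
    c k * v k             ≈⟨ v-solves k+1<p ⟨
    + suc k * v (suc k)   ∎)
    where
    open ≈-Reasoning
    uₖ≈vₖ : u k ≈ v k
    uₖ≈vₖ = recurrence-unique {c} {u} {v} u-solves v-solves u₀≈v₀ (ℕ.<-trans (ℕ.n<1+n k) k+1<p)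

module Residues where

  open import Data.Nat using (suc; s≤s; _<_; _%_)
  open import Data.Nat.DivMod using (m%n<n; m∣n⇒o%n%m≡o%m)
  open import Data.Nat.Divisibility using (divides)
  open import Data.Product using (_×_; _,_)
  open import Relation.Binary.PropositionalEquality using (_≡_; refl; trans)

  odd⇒%6 : ∀ m → m % 2 ≡ 1 → (m % 3 ≡ 1 → m % 6 ≡ 1) × (m % 3 ≡ 2 → m % 6 ≡ 5)
  odd⇒%6 m m%2≡1 with residues (m % 6) (m%n<n m 6) (trans (m∣n⇒o%n%m≡o%m 2 6 m (divides 3 refl)) m%2≡1)
    where
    residues : ∀ r → r < 6 → r % 2 ≡ 1 → (r % 3 ≡ 1 → r ≡ 1) × (r % 3 ≡ 2 → r ≡ 5)
    residues 1 _ _ = (λ _ → refl) , (λ ())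
    residues 3 _ _ = (λ ()) , (λ ())
    residues 5 _ _ = (λ ()) , (λ _ → refl)
    residues 0 _ ()
    residues 2 _ ()
    residues 4 _ ()
    residues (suc (suc (suc (suc (suc (suc _)))))) (s≤s (s≤s (s≤s (s≤s (s≤s (s≤s ())))))) _
  ... | ≡1 , ≡5 = (λ m%3≡1 → ≡1 (trans m%6%3≡m%3 m%3≡1)) , (λ m%3≡2 → ≡5 (trans m%6%3≡m%3 m%3≡2))
    where
    m%6%3≡m%3 : m % 6 % 3 ≡ m % 3
    m%6%3≡m%3 = m∣n⇒o%n%m≡o%m 3 6 m (divides 2 refl)

open Residues

open import Data.Nat using (suc; _*_)

module OddPrime (n : ℕ) (p-prime : Prime (suc (2 * n))) where

  open import Data.Nat as ℕ using (zero; _<_; _%_)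
  import Data.Nat.Properties as ℕ
  open import Data.Nat.DivMod using ([m+kn]%n≡m%n)
  open import Data.Nat.Combinatorics using (_C_)
  import Data.Nat.Tactic.RingSolver as ℕ-Solver
  open import Data.Integer using (+_; -_; _+_; _-_; 0ℤ; 1ℤ) renaming (_*_ to _·_)
  import Data.Integer.Properties as ℤ
  open import Data.Integer.Tactic.RingSolver using (solve-∀)
  open import Data.Fin using (Fin; toℕ)
  open import Data.Product using (_×_; _,_; proj₁; proj₂)
  open import Function using (_∘_; id)
  open import Relation.Binary.PropositionalEquality as ≡ using (_≡_)
  open import Defs using (centralBinomSum)

  p : ℕ
  p = suc (2 * n)

  open ModuloPrime p p-prime
  open CommutativeSemiring ℤ/m using (semiring; +-monoid)
  open import Algebra.Properties.Semiring.Exp semiring using (_^_)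
  open import Algebra.Properties.Semiring.Sum semiring using (sum-syntax; sum-cong-≋; *-distribˡ-sum; sum-replicate-zero)
  open import Algebra.Properties.Semiring.Mult semiring using () renaming (_×_ to _×ₙ_)
  open import Algebra.Properties.CommutativeSemiring.Binomial ℤ/m using (theorem)
  open CommutativeSemiringFacts ℤ/m using (1#^n≈1#)
  open IndexedSum +-monoid using (∑-split)

  pos-*≡pos-* : ∀ a b c d → a * b ≡ c * d → + a · + b ≡ + c · + d
  pos-*≡pos-* a b c d ab≡cd = ≡.trans (≡.sym (ℤ.pos-* a b)) (≡.trans (≡.cong +_ ab≡cd) (ℤ.pos-* c d))

  central : ℕ → ℤ
  central k = + ((2 * k) C k)

  centralRatio : ℕ → ℤ
  centralRatio k = + (2 * suc (2 * k))

  central-step : ∀ k → + suc k · central (suc k) ≡ centralRatio k · central k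
  central-step k = pos-*≡pos-* (suc k) _ (2 * suc (2 * k)) _ ([k+1]*[2k+2]C[k+1]≡2[2k+1]*[2k]Ck k)

  central-solves : SolvesRecurrence centralRatio central
  central-solves {k} _ = ≈-reflexive (central-step k)

  binomialHalf : ℕ → ℤ
  binomialHalf k = + (n C k) · (- + 4) ^ k

  binomialHalf-solves : SolvesRecurrence centralRatio binomialHalf
  binomialHalf-solves {k} _ =
    ≈-trans (≈-reflexive (rearrange (+ suc k) (+ c₁) (centralRatio k) (+ c₀) (+ p) ((- + 4) ^ k) lifted))
            (x+q*m≈x (centralRatio k · binomialHalf k) (- (+ 2 · binomialHalf k)))
    where
    c₀ c₁ : ℕ
    c₀ = n C k
    c₁ = n C suc k
    lifted : + 4 · (+ suc k · + c₁) + centralRatio k · + c₀ ≡ + 2 · + p · + c₀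
    lifted = begin
      + 4 · (+ suc k · + c₁) + centralRatio k · + c₀
        ≡⟨ ≡.cong₂ _+_ (≡.trans (ℤ.pos-* 4 (suc k * c₁)) (≡.cong (+ 4 ·_) (ℤ.pos-* (suc k) c₁)))
                       (ℤ.pos-* (2 * suc (2 * k)) c₀) ⟨
      + (4 * (suc k * c₁)) + + (2 * suc (2 * k) * c₀)
        ≡⟨ ℤ.pos-+ (4 * (suc k * c₁)) (2 * suc (2 * k) * c₀) ⟨
      + (4 * (suc k * c₁) ℕ.+ 2 * suc (2 * k) * c₀)
        ≡⟨ ≡.cong +_ (4[k+1]nC[k+1]+2[2k+1]nCk≡2[2n+1]nCk n k) ⟩
      + (2 * p * c₀)
        ≡⟨ ≡.trans (ℤ.pos-* (2 * p) c₀) (≡.cong (_· + c₀) (ℤ.pos-* 2 p)) ⟩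
      + 2 · + p · + c₀ ∎
      where open ≡.≡-Reasoning
    rearrange : ∀ S C₁ T C₀ P X → + 4 · (S · C₁) + T · C₀ ≡ + 2 · P · C₀ →
                S · (C₁ · (- + 4 · X)) ≡ T · (C₀ · X) + (- (+ 2 · (C₀ · X))) · P
    rearrange S C₁ T C₀ P X h =
      ≡.trans (expand S C₁ T C₀ X) (≡.trans (≡.cong (λ z → T · (C₀ · X) - X · z) h) (collect T C₀ P X))
      where
      expand : ∀ S C₁ T C₀ X → S · (C₁ · (- + 4 · X)) ≡ T · (C₀ · X) - X · (+ 4 · (S · C₁) + T · C₀)
      expand = solve-∀
      collect : ∀ T C₀ P X → T · (C₀ · X) - X · (+ 2 · P · C₀) ≡ T · (C₀ · X) + (- (+ 2 · (C₀ · X))) · P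
      collect = solve-∀

  central≈binomialHalf : ∀ {k} → k < p → central k ≈ binomialHalf k
  central≈binomialHalf =
    recurrence-unique {centralRatio} {central} {binomialHalf} central-solves binomialHalf-solves ≈-refl

  [p+i]Ci≈1 : ∀ {i} → i < p → + ((p ℕ.+ i) C i) ≈ 1ℤ
  [p+i]Ci≈1 = recurrence-unique {+_ ∘ suc} {λ i → + ((p ℕ.+ i) C i)} {λ _ → 1ℤ} solves (λ _ → ≈-refl) ≈-refl
    where
    solves : SolvesRecurrence (+_ ∘ suc) (λ i → + ((p ℕ.+ i) C i))
    solves {i} _ = begin
      + suc i · + ((p ℕ.+ suc i) C suc i)   ≡⟨ ≡.cong (λ m → + suc i · + (m C suc i)) (ℕ.+-suc p i) ⟩
      + suc i · + (suc (p ℕ.+ i) C suc i)   ≡⟨ pos-*≡pos-* (suc i) (suc (p ℕ.+ i) C suc i) (suc (p ℕ.+ i)) ((p ℕ.+ i) C i)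
                                                 (≡.trans (ℕ.*-comm (suc i) _) ([n+1]C[k+1]*[k+1]≡[n+1]*nCk (p ℕ.+ i) i)) ⟩
      + suc (p ℕ.+ i) · + ((p ℕ.+ i) C i)   ≈⟨ *-congʳ (+ ((p ℕ.+ i) C i)) (≡n+kp⇒+≈+n (suc i) 1 (shift n i)) ⟩
      + suc i · + ((p ℕ.+ i) C i)           ∎
      where
      open ≈-Reasoning
      shift : ∀ n i → suc (suc (2 * n) ℕ.+ i) ≡ suc i ℕ.+ 1 * suc (2 * n)
      shift = ℕ-Solver.solve-∀

  [2p]Cp≡2[p+2n]C[2n] : (2 * p) C p ≡ 2 * ((p ℕ.+ 2 * n) C (2 * n))
  [2p]Cp≡2[p+2n]C[2n] = ℕ.*-cancelʳ-≡ _ _ p (begin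
    ((2 * p) C p) * p                          ≡⟨ ≡.cong (λ m → (m C p) * p) (2p≡1+p+2n n) ⟩
    (suc (p ℕ.+ 2 * n) C p) * p                ≡⟨ [n+1]C[k+1]*[k+1]≡[n+1]*nCk (p ℕ.+ 2 * n) (2 * n) ⟩
    suc (p ℕ.+ 2 * n) * X                      ≡⟨ ≡.cong (_* X) (2p≡1+p+2n n) ⟨
    2 * p * X                                  ≡⟨ swap 2 p X ⟩
    2 * X * p                                  ∎)
    where
    open ≡.≡-Reasoning
    X : ℕ
    X = (p ℕ.+ 2 * n) C (2 * n)
    2p≡1+p+2n : ∀ n → 2 * suc (2 * n) ≡ suc (suc (2 * n) ℕ.+ 2 * n)
    2p≡1+p+2n = ℕ-Solver.solve-∀
    swap : ∀ a b c → a * b * c ≡ a * c * b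
    swap = ℕ-Solver.solve-∀

  central-p≈2 : central p ≈ + 2
  central-p≈2 = begin
    + ((2 * p) C p)                    ≡⟨ ≡.cong +_ [2p]Cp≡2[p+2n]C[2n] ⟩
    + (2 * ((p ℕ.+ 2 * n) C (2 * n)))  ≡⟨ ℤ.pos-* 2 ((p ℕ.+ 2 * n) C (2 * n)) ⟩
    + 2 · + ((p ℕ.+ 2 * n) C (2 * n))  ≈⟨ *-congˡ (+ 2) ([p+i]Ci≈1 (ℕ.n<1+n (2 * n))) ⟩
    + 2 · 1ℤ                           ∎
    where open ≈-Reasoning

  central[p+j]≈2central[j] : ∀ {j} → j < p → central (p ℕ.+ j) ≈ + 2 · central j
  central[p+j]≈2central[j] = recurrence-unique {centralRatio} {central ∘ (p ℕ.+_)} {λ j → + 2 · central j}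
    shifted-solves doubled-solves (≈-trans (≈-reflexive (≡.cong central (ℕ.+-identityʳ p))) central-p≈2)
    where
    shifted-solves : SolvesRecurrence centralRatio (central ∘ (p ℕ.+_))
    shifted-solves {j} _ = begin
      + suc j · central (p ℕ.+ suc j)            ≡⟨ ≡.cong (λ m → + suc j · central m) (ℕ.+-suc p j) ⟩
      + suc j · central (suc (p ℕ.+ j))          ≈⟨ *-congʳ _ (≡n+kp⇒+≈+n (suc j) 1 (shift₁ n j)) ⟨
      + suc (p ℕ.+ j) · central (suc (p ℕ.+ j))  ≡⟨ central-step (p ℕ.+ j) ⟩
      centralRatio (p ℕ.+ j) · central (p ℕ.+ j)  ≈⟨ *-congʳ _ (≡n+kp⇒+≈+n (2 * suc (2 * j)) 4 (shift₄ n j)) ⟩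
      centralRatio j · central (p ℕ.+ j)          ∎
      where
      open ≈-Reasoning
      shift₁ : ∀ n j → suc (suc (2 * n) ℕ.+ j) ≡ suc j ℕ.+ 1 * suc (2 * n)
      shift₁ = ℕ-Solver.solve-∀
      shift₄ : ∀ n j → 2 * suc (2 * (suc (2 * n) ℕ.+ j)) ≡ 2 * suc (2 * j) ℕ.+ 4 * suc (2 * n)
      shift₄ = ℕ-Solver.solve-∀
    doubled-solves : SolvesRecurrence centralRatio (λ j → + 2 · central j)
    doubled-solves {j} _ = ≈-reflexive (begin
      + suc j · (+ 2 · central (suc j))    ≡⟨ exchange (+ suc j) (+ 2) (central (suc j)) ⟩
      + 2 · (+ suc j · central (suc j))    ≡⟨ ≡.cong (+ 2 ·_) (central-step j) ⟩
      + 2 · (centralRatio j · central j)   ≡⟨ exchange (+ 2) (centralRatio j) (central j) ⟩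
      centralRatio j · (+ 2 · central j)   ∎)
      where
      open ≡.≡-Reasoning
      exchange : ∀ a b c → a · (b · c) ≡ b · (a · c)
      exchange = solve-∀

  ∑binomialHalf≈[-3]^n : ∑[ k < p ] binomialHalf (toℕ k) ≈ (- + 3) ^ n
  ∑binomialHalf≈[-3]^n = begin
    ∑[ k < p ] binomialHalf (toℕ k)
      ≡⟨ ≡.cong (λ N → ∑[ k < N ] binomialHalf (toℕ k)) (p≡[n+1]+n n) ⟩
    ∑[ k < suc n ℕ.+ n ] binomialHalf (toℕ k)
      ≈⟨ ∑-split (suc n) n binomialHalf ⟩
    ∑[ k < suc n ] binomialHalf (toℕ k) + ∑[ k < n ] binomialHalf (suc n ℕ.+ toℕ k)
      ≈⟨ +-cong (≈-sym binomial) tail≈0 ⟩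
    (- + 3) ^ n + 0ℤ
      ≡⟨ ℤ.+-identityʳ _ ⟩
    (- + 3) ^ n
      ∎
    where
    open ≈-Reasoning
    p≡[n+1]+n : ∀ n → suc (2 * n) ≡ suc n ℕ.+ n
    p≡[n+1]+n = ℕ-Solver.solve-∀
    term≈ : ∀ (k : Fin (suc n)) → (n C toℕ k) ×ₙ ((- + 4) ^ toℕ k · 1ℤ ^ (n ℕ.∸ toℕ k)) ≈ binomialHalf (toℕ k)
    term≈ k = ≈-trans (≈-reflexive (×≡pos-* (n C toℕ k) _)) (*-congˡ (+ (n C toℕ k))
                (≈-trans (*-congˡ ((- + 4) ^ toℕ k) (1#^n≈1# (n ℕ.∸ toℕ k))) (≈-reflexive (ℤ.*-identityʳ _))))
    binomial : (- + 3) ^ n ≈ ∑[ k < suc n ] binomialHalf (toℕ k)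
    binomial = ≈-trans (theorem n (- + 4) 1ℤ) (sum-cong-≋ term≈)
    tail≈0 : ∑[ k < n ] binomialHalf (suc n ℕ.+ toℕ k) ≈ 0ℤ
    tail≈0 = ≈-trans (sum-cong-≋ vanish) (sum-replicate-zero n)
      where
      vanish : ∀ (k : Fin n) → binomialHalf (suc n ℕ.+ toℕ k) ≈ 0ℤ
      vanish k = ≈-reflexive (≡.trans (≡.cong (λ c → + c · X) (n<k⇒nCk≡0 (ℕ.m≤m+n (suc n) (toℕ k)))) (ℤ.*-zeroˡ X))
        where
        X : ℤ
        X = (- + 4) ^ (suc n ℕ.+ toℕ k)

  centralBinomSum≈3[-3]^n : + centralBinomSum (2 * p) ≈ + 3 · (- + 3) ^ n
  centralBinomSum≈3[-3]^n = begin
    + centralBinomSum (2 * p)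
      ≡⟨ pos-sum-map-applyUpTo (λ k → (2 * k) C k) id (2 * p) ⟩
    ∑[ k < 2 * p ] central (toℕ k)
      ≡⟨ ≡.cong (λ N → ∑[ k < p ℕ.+ N ] central (toℕ k)) (ℕ.+-identityʳ p) ⟩
    ∑[ k < p ℕ.+ p ] central (toℕ k)
      ≈⟨ ∑-split p p central ⟩
    S + ∑[ k < p ] central (p ℕ.+ toℕ k)
      ≈⟨ +-congˡ S (∑-cong central[p+j]≈2central[j]) ⟩
    S + ∑[ k < p ] (+ 2 · central (toℕ k))
      ≈⟨ +-congˡ S (*-distribˡ-sum {p} (+ 2) (λ k → central (toℕ k))) ⟨
    S + + 2 · S
      ≡⟨ triple S ⟩
    + 3 · S
      ≈⟨ *-congˡ (+ 3) (≈-trans (∑-cong central≈binomialHalf) ∑binomialHalf≈[-3]^n) ⟩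
    + 3 · (- + 3) ^ n
      ∎
    where
    open ≈-Reasoning
    S : ℤ
    S = ∑[ k < p ] central (toℕ k)
    triple : ∀ x → x + + 2 · x ≡ + 3 · x
    triple = solve-∀

  module Eisenstein where
    open CommutativeSemiring ℤ[ω]/m using ()
      renaming (semiring to ℤ[ω]-semiring; setoid to ℤ[ω]-setoid; *-congˡ to ⊗-congˡ; +-cong to ⊕-cong)
    open import Algebra.Properties.Semiring.Exp ℤ[ω]-semiring using (^-assocʳ) renaming (_^_ to _^ω_)
    open import Algebra.Properties.Semiring.Mult ℤ[ω]-semiring using () renaming (_×_ to _×ω_)
    open CommutativeSemiringFacts ℤ[ω]/m using (frobenius; ^-periodic)

    ω 1+ω : ℤ[ω]
    ω   = 0ℤ , 1ℤ
    1+ω = 1ℤ , 1ℤ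

    k×1≡[k,0] : ∀ k → k ×ω (1ℤ , 0ℤ) ≡ (+ k , 0ℤ)
    k×1≡[k,0] zero    = ≡.refl
    k×1≡[k,0] (suc k) = ≡.cong (_⊕_ (1ℤ , 0ℤ)) (k×1≡[k,0] k)

    p×1≋0 : p ×ω (1ℤ , 0ℤ) ≋ (0ℤ , 0ℤ)
    p×1≋0 = ≡.subst (_≋ (0ℤ , 0ℤ)) (≡.sym (k×1≡[k,0] p)) (m≈0 , ≈-refl)

    [x,0]^k≋[x^k,0] : ∀ x k → (x , 0ℤ) ^ω k ≋ (x ^ k , 0ℤ)
    [x,0]^k≋[x^k,0] x zero    = ≈-refl , ≈-refl
    [x,0]^k≋[x^k,0] x (suc k) with [x,0]^k≋[x^k,0] x k
    ... | ih₁ , ih₂ =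
      ≈-trans (minus-cong (*-congˡ x ih₁) (*-congˡ 0ℤ ih₂)) (≈-reflexive (real x (x ^ k))) ,
      ≈-trans (minus-cong (+-cong (*-congˡ x ih₂) (*-congˡ 0ℤ ih₁)) (*-congˡ 0ℤ ih₂)) (≈-reflexive (imag x (x ^ k)))
      where
      real : ∀ x y → x · y - 0ℤ · 0ℤ ≡ x · y
      real = solve-∀
      imag : ∀ x y → x · 0ℤ + 0ℤ · y - 0ℤ · 0ℤ ≡ 0ℤ
      imag = solve-∀

    rootPowerSum : ℕ → ℤ
    rootPowerSum r = proj₁ (ω ^ω r ⊕ 1+ω ^ω r)

    [-3]^n≈ω^[p%6]+[1+ω]^[p%6] : (- + 3) ^ n ≈ rootPowerSum (p % 6)
    [-3]^n≈ω^[p%6]+[1+ω]^[p%6] = ≈-trans (≈-reflexive (real ((- + 3) ^ n))) (proj₁ chain)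
      where
      real : ∀ c → c ≡ 1ℤ · c - + 2 · 0ℤ
      real = solve-∀
      open import Relation.Binary.Reasoning.Setoid ℤ[ω]-setoid
      -- (1 + 2ω)² = -3 and ω⁶ = (1 + ω)⁶ = 1 hold by evaluation.
      chain : (1ℤ , + 2) ⊗ ((- + 3) ^ n , 0ℤ) ≋ ω ^ω (p % 6) ⊕ 1+ω ^ω (p % 6)
      chain = begin
        (1ℤ , + 2) ⊗ ((- + 3) ^ n , 0ℤ)        ≈⟨ ⊗-congˡ {1ℤ , + 2} ([x,0]^k≋[x^k,0] (- + 3) n) ⟨
        (1ℤ , + 2) ⊗ (- + 3 , 0ℤ) ^ω n         ≈⟨ ⊗-congˡ {1ℤ , + 2} (^-assocʳ (1ℤ , + 2) 2 n) ⟩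
        (ω ⊕ 1+ω) ^ω p                         ≈⟨ frobenius p-prime p×1≋0 ω 1+ω ⟩
        ω ^ω p ⊕ 1+ω ^ω p                      ≈⟨ ⊕-cong (^-periodic 6 (≈-refl , ≈-refl) p)
                                                         (^-periodic 6 (≈-refl , ≈-refl) p) ⟩
        ω ^ω (p % 6) ⊕ 1+ω ^ω (p % 6)          ∎

    [-3]^n≈1 : p % 6 ≡ 1 → (- + 3) ^ n ≈ 1ℤ
    [-3]^n≈1 p%6≡1 = ≈-trans [-3]^n≈ω^[p%6]+[1+ω]^[p%6] (≈-reflexive (≡.cong rootPowerSum p%6≡1))

    [-3]^n≈-1 : p % 6 ≡ 5 → (- + 3) ^ n ≈ - 1ℤ
    [-3]^n≈-1 p%6≡5 = ≈-trans [-3]^n≈ω^[p%6]+[1+ω]^[p%6] (≈-reflexive (≡.cong rootPowerSum p%6≡5))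

  open Eisenstein using ([-3]^n≈1; [-3]^n≈-1)

  p%2≡1 : p % 2 ≡ 1
  p%2≡1 = ≡.trans (≡.cong (_% 2) (p≡1+n*2 n)) ([m+kn]%n≡m%n 1 n 2)
    where p≡1+n*2 : ∀ n → suc (2 * n) ≡ 1 ℕ.+ n * 2
          p≡1+n*2 = ℕ-Solver.solve-∀

  corollary-odd : (p % 3 ≡ 1 → centralBinomSum (2 * p) % p ≡ 3 % p) ×
                  (p % 3 ≡ 2 → (centralBinomSum (2 * p) ℕ.+ 3) % p ≡ 0)
  corollary-odd = (λ p%3≡1 → +≈+⇒%≡ (residue-1 (proj₁ (odd⇒%6 p p%2≡1) p%3≡1)))
                , (λ p%3≡2 → +≈+⇒%≡ (residue-5 (proj₂ (odd⇒%6 p p%2≡1) p%3≡2)))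
    where
    open ≈-Reasoning
    S : ℕ
    S = centralBinomSum (2 * p)
    residue-1 : p % 6 ≡ 1 → + S ≈ + 3
    residue-1 p%6≡1 = begin
      + S                  ≈⟨ centralBinomSum≈3[-3]^n ⟩
      + 3 · (- + 3) ^ n    ≈⟨ *-congˡ (+ 3) ([-3]^n≈1 p%6≡1) ⟩
      + 3                  ∎
    residue-5 : p % 6 ≡ 5 → + (S ℕ.+ 3) ≈ + 0
    residue-5 p%6≡5 = begin
      + (S ℕ.+ 3)   ≡⟨ ℤ.pos-+ S 3 ⟩
      + S + + 3     ≈⟨ +-cong S≈-3 (≈-refl {+ 3}) ⟩
      - + 3 + + 3   ≡⟨⟩
      + 0           ∎
      where
      S≈-3 : + S ≈ - + 3
      S≈-3 = ≈-trans centralBinomSum≈3[-3]^n (*-congˡ (+ 3) ([-3]^n≈-1 p%6≡5))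

open import Defs
open import Data.Nat using (_+_; _%_; NonZero; s≤s; _≟_; _/_)
open import Data.Product using (_×_; _,_; ∃-syntax)
open import Relation.Binary.PropositionalEquality using (_≡_; _≢_; refl; sym; trans; cong)
import Data.Nat.Properties as ℕ
open import Data.Nat.Divisibility using (m%n≡0⇒n∣m)
open import Data.Nat.DivMod using (m≡m%n+[m/n]*n; m%n<n)
open import Data.Nat.Primality using (prime⇒irreducible)
open import Data.Sum using (inj₁; inj₂)
open import Relation.Nullary using (yes; no; contradiction)

prime≢2⇒odd : ∀ {p} → Prime p → p ≢ 2 → ∃[ n ] p ≡ suc (2 * n)
prime≢2⇒odd {p} p-prime p≢2 with p % 2 in p%2≡r | m%n<n p 2
... | 0 | _ with prime⇒irreducible p-prime (m%n≡0⇒n∣m p 2 p%2≡r)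
...   | inj₁ ()
...   | inj₂ 2≡p = contradiction (sym 2≡p) p≢2
prime≢2⇒odd {p} _ _ | 1 | _ =
  p / 2 , trans (m≡m%n+[m/n]*n p 2) (trans (cong (λ r → r + p / 2 * 2) p%2≡r) (cong suc (ℕ.*-comm (p / 2) 2)))
prime≢2⇒odd {p} _ _ | suc (suc _) | s≤s (s≤s ())

corollary2p3 : (p : ℕ) .⦃ _ : NonZero p ⦄ → Prime p →
    ((p % 3 ≡ 1 → centralBinomSum (2 * p) % p ≡ 3 % p) ×
     (p % 3 ≡ 2 → (centralBinomSum (2 * p) + 3) % p ≡ 0))
corollary2p3 p p-prime with p ≟ 2
... | yes refl = (λ ()) , (λ _ → refl)
... | no p≢2 with prime≢2⇒odd p-prime p≢2
...   | n , refl = OddPrime.corollary-odd n p-prime
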